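{- Let $m,k$ be constants, $\epsilon\in(0,1)$ with $1/\epsilon$ an integer, let $\mathcal{J}$ be an instance of $P_m(O_k)\,||\,C_{\max}$ with minimum makespan at most $1$, and let $\gamma$ and $\mathcal{J}'$ be the parameter and special instance output by Algorithm Reduce on $(\mathcal{J},\epsilon)$. Then the minimum makespan over all restricted schedules of $\mathcal{J}'$ is at most $C^*_{\max}(\mathcal{J}')+mk^2\gamma$, where $C^*_{\max}(\mathcal{J}')$ is the minimum makespan of $\mathcal{J}'$ over all feasible schedules.
   Context: Problem $P_m(O_k)\,||\,C_{\max}$: $m$ identical open shops, each with $k$ machines $M_{\ell,1},\dots,M_{\ell,k}$; jobs $J_i$ with $k$ operations $O_{i,j}$ of nonnegative processing time $p_{i,j}$; each job is assigned to one shop, $O_{i,j}$ is processed non-preemptively on the shop's $j$-th machine, each machine processes one operation at a time, operations of the same job do not overlap; objective is the makespan. For $\gamma>0$, a job is big w.r.t. $\gamma$ if some $p_{i,j}\ge\gamma$, small otherwise; an operation of a small job is $\gamma^2$-big if $p_{i,j}\ge\gamma^2$. Algorithm Reduce: set $\delta=\frac{\epsilon}{14mk^3}$, $\gamma_x=\delta^{2^x}$; for $x=0,1,\dots,mk/\delta$, let $L(\gamma_x)$ be the total processing time of all $\gamma_x^2$-big operations; at the first $x$ with $L(\gamma_x)\le\delta$, set $\gamma=\gamma_x$, set the processing time of every $\gamma^2$-big operation to $0$, round every operation time of every big job up to the nearest multiple of $\gamma^2$, and output $\gamma$ and the resulting instance $\mathcal{J}'$. A feasible schedule of $\mathcal{J}'$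 is restricted if every operation of every big job (w.r.t. $\gamma$) starts at a time that is an integer multiple of $\gamma^2$ (the beginning of some interval $[(t-1)\gamma^2,t\gamma^2)$).
   Formalization: The processing times $p_{i,j}$ and the start times of all schedules take values in the rationals. -}

module Defs where

open import Data.Bool using (Bool; true; false; if_then_else_; _∧_; not)
open import Data.Nat as ℕ using (ℕ; zero; suc; NonZero)
open import Data.Nat.Properties using (m*n≢0; m^n≢0)
open import Data.Integer using (ℤ; +_)
open import Data.Fin using (Fin; zero; suc)
open import Data.Product using (∃; Σ; _×_)
open import Data.Sum using (_⊎_)
open import Relation.Binary.PropositionalEquality using (_≡_; _≢_)
open import Data.Rational as ℚ
  using (ℚ; 0ℚ; _+_; _*_; _≤_; _≤ᵇ_; _⊔_; _/_; ceiling)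

sumFin : (n : ℕ) → (Fin n → ℚ) → ℚ
sumFin zero    f = 0ℚ
sumFin (suc n) f = f zero + sumFin n (λ i → f (suc i))

maxFin : (n : ℕ) → (Fin n → ℚ) → ℚ
maxFin zero    f = 0ℚ
maxFin (suc n) f = f zero ⊔ maxFin n (λ i → f (suc i))

anyFin : (n : ℕ) → (Fin n → Bool) → Bool
anyFin zero    f = false
anyFin (suc n) f = if f zero then true else anyFin n (λ i → f (suc i))

ℕ→ℚ : ℕ → ℚ
ℕ→ℚ t = (+ t) / 1

ℤ→ℚ : ℤ → ℚ
ℤ→ℚ z = z / 1

-- Instances of P_m(O_k) || Cmax: n jobs, k operations each.
-- p i j = processing time of O_{i,j} (nonnegativity is a hypothesis).

Times : ℕ → ℕ → Set
Times n k = Fin n → Fin k → ℚ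

-- A schedule: assignment of every job to one of the m shops, and
-- a start time for every operation (O_{i,j} runs on machine j of its shop
-- during [start i j , start i j + p i j)).
record Schedule (m n k : ℕ) : Set where
  field
    shop  : Fin n → Fin m
    start : Fin n → Fin k → ℚ
open Schedule public

-- the half-open intervals [a, a+p) and [b, b+q) do not intersect
NoOverlap : ℚ → ℚ → ℚ → ℚ → Set
NoOverlap a p b q = (a + p ≤ b) ⊎ (b + q ≤ a) ⊎ (p ≡ 0ℚ) ⊎ (q ≡ 0ℚ)

record Feasible {m n k : ℕ} (p : Times n k) (σ : Schedule m n k) : Set where
  field
    nonneg  : ∀ i j → 0ℚ ≤ start σ i j
    machine : ∀ i i' j → i ≢ i' → shop σ i ≡ shop σ i' →
              NoOverlap (start σ i j) (p i j) (start σ i' j) (p i' j)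
    job     : ∀ i j j' → j ≢ j' →
              NoOverlap (start σ i j) (p i j) (start σ i j') (p i j')

makespan : {m n k : ℕ} → Times n k → Schedule m n k → ℚ
makespan {n = n} {k} p σ = maxFin n (λ i → maxFin k (λ j → start σ i j + p i j))

Big : {n k : ℕ} → ℚ → Times n k → Fin n → Set
Big {k = k} γ p i = ∃ λ (j : Fin k) → γ ≤ p i j

big? : {n k : ℕ} → ℚ → Times n k → Fin n → Bool
big? {k = k} γ p i = anyFin k (λ j → γ ≤ᵇ p i j)

sqBig? : {n k : ℕ} → ℚ → Times n k → Fin n → Fin k → Bool
sqBig? γ p i j = not (big? γ p i) ∧ (γ * γ ≤ᵇ p i j)

L : {n k : ℕ} → ℚ → Times n k → ℚ
L {n} {k} γ p =
  sumFin n (λ i → sumFin k (λ j → if sqBig? γ p i j then p i j else 0ℚ))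

-- Parameters of Algorithm Reduce, for ε = 1/N.
-- δ = ε/(14 m k³) = 1/D with D = 14 m k³ N,  γ_x = δ^(2^x) = 1/D^(2^x).

D : (m k N : ℕ) → ℕ
D m k N = 14 ℕ.* m ℕ.* k ℕ.^ 3 ℕ.* N

module _ (m k N : ℕ) .{{_ : NonZero m}} .{{_ : NonZero k}} .{{_ : NonZero N}} where

  private
    instance
      D≢0 : NonZero (D m k N)
      D≢0 = m*n≢0 (14 ℕ.* m ℕ.* k ℕ.^ 3) N {{m*n≢0 (14 ℕ.* m) (k ℕ.^ 3) {{m*n≢0 14 m}} {{m^n≢0 k 3}}}}

  δ : ℚ
  δ = (+ 1) / D m k N

  Γ : ℕ → ℕ
  Γ x = D m k N ℕ.^ (2 ℕ.^ x)

  γ : ℕ → ℚ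
  γ x = (+ 1) / Γ x
    where instance _ = m^n≢0 (D m k N) (2 ℕ.^ x)

  roundUp : ℕ → ℚ → ℚ
  roundUp x q = ℤ→ℚ (ceiling (q * ℕ→ℚ (Γ x ℕ.* Γ x))) * (γ x * γ x)

  reduce : {n : ℕ} → ℕ → Times n k → Times n k
  reduce x p i j =
    if big? (γ x) p i then roundUp x (p i j)
    else (if γ x * γ x ≤ᵇ p i j then 0ℚ else p i j)

  ReduceStopsAt : {n : ℕ} → Times n k → ℕ → Set
  ReduceStopsAt p x =
    (x ℕ.≤ m ℕ.* k ℕ.* D m k N) × (L (γ x) p ≤ δ) ×
    (∀ y → y ℕ.< x → δ ℚ.< L (γ y) p)

Restricted : {m n k : ℕ} → ℚ → Times n k → Schedule m n k → Set
Restricted {k = k} γ p σ =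
  ∀ i → Big γ p i → ∀ (j : Fin k) → ∃ λ (t : ℕ) → start σ i j ≡ ℕ→ℚ t * (γ * γ)

{-# OPTIONS --safe #-}
-- Call an operation heavy if its original length is ≥ γ; rounding makes no small job big, so
-- every big job of the reduced instance has a heavy operation.  Let ts list, for each heavy
-- operation, the k start times in σ of its job, and let e = γ².  Delaying every start time t by
-- d(t), with d ≥ 0 nondecreasing, keeps disjoint intervals disjoint, so the delayed schedule is
-- feasible and its makespan grows by at most sup d.  Each a ∈ ts is moved to the grid point
-- e·(⌈a/e⌉ + #{b ∈ ts | b < a}); these displacements are nondecreasing along ts and at most
-- e·|ts|, and d is their running maximum.  Finally, in a schedule of the original instance of
-- makespan ≤ 1, laying the km machines end to end on [0, km] makes the heavy operations disjoint
-- intervals of length ≥ γ, so there are at most km/γ of them and e·|ts| ≤ γ²·k·km/γ = mk²γ.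
module Submission where

open import Defs
open import Data.Bool using (true; false; T; if_then_else_)
open import Data.Unit using (tt)
open import Data.Nat as ℕ using (ℕ; zero; suc; NonZero; z≤n; s≤s)
import Data.Nat.Properties as ℕP
open import Data.Nat.Coprimality as Coprime using (1-coprimeTo)
open import Data.Integer as ℤ using (+_; -[1+_])
import Data.Integer.Properties as ℤP
import Data.Integer.DivMod as ℤD
open import Data.Fin using (Fin; zero; suc; toℕ; combine)
open import Data.Fin.Properties using (toℕ<n; toℕ-injective; combine-injective)
open import Data.List using (List; []; _∷_; length; map; filter; concatMap; tabulate; cartesianProduct; allFin)
open import Data.List.Properties using (length-filter; length-++; length-tabulate)
open import Data.List.Membership.Propositional using (_∈_)
open import Data.List.Membership.Propositional.Properties
  using (∈-map⁺; ∈-filter⁺; ∈-filter⁻; ∈-concatMap⁺; ∈-tabulate⁺; ∈-cartesianProduct⁺; ∈-allFin)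
open import Data.List.Relation.Unary.Any as Any using (here; there)
open import Data.List.Relation.Unary.All as All using (All; []; _∷_)
import Data.List.Relation.Unary.All.Properties as All
open import Data.List.Relation.Unary.AllPairs as AllPairs using (AllPairs; []; _∷_)
import Data.List.Relation.Unary.AllPairs.Properties as AllPairs
open import Data.List.Relation.Unary.Unique.Propositional.Properties using (allFin⁺; cartesianProduct⁺)
open import Data.List.Relation.Binary.Subset.Propositional.Properties using (map⁺; filter⁺′; ⊆-refl)
open import Data.Product using (∃; _×_; _,_; proj₁; proj₂)
open import Data.Sum using (inj₁; inj₂)
open import Data.Rational as ℚ using (ℚ; mkℚ; 0ℚ; 1ℚ; _+_; _*_; _-_; -_; _≤_; _<_; ↥_; ↧_; Positive; 1/_; floor; ceiling)
open import Data.Rational.Properties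
open import Data.Rational.Solver using (module +-*-Solver)
open import Relation.Binary.Bundles using (DecTotalOrder)
open import Algebra.Bundles using (CommutativeMonoid)
open import Algebra.Properties.CommutativeSemigroup (CommutativeMonoid.commutativeSemigroup +-0-commutativeMonoid)
  using (xy∙z≈xz∙y)
open import Data.List.Extrema (DecTotalOrder.totalOrder ≤-decTotalOrder) using (max; max-mono-⊆; max≤v⁺; v≤max⁺; max≈v⁺)
open import Function using (_∘_)
open import Relation.Binary.PropositionalEquality
open import Relation.Binary.Definitions using (tri<; tri≈; tri>)
open import Relation.Nullary using (Dec; yes; no; ¬_; contradiction)
open import Relation.Nullary.Decidable using (¬?)
open import Relation.Unary using (Decidable)
open +-*-Solver

ℕ→ℚ≡mkℚ : ∀ a → ℕ→ℚ a ≡ mkℚ (+ a) 0 (Coprime.sym (1-coprimeTo a))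
ℕ→ℚ≡mkℚ a = ↥p/↧p≡p (mkℚ (+ a) 0 (Coprime.sym (1-coprimeTo a)))

ℕ→ℚ-homo-+ : ∀ a b → ℕ→ℚ (a ℕ.+ b) ≡ ℕ→ℚ a + ℕ→ℚ b
ℕ→ℚ-homo-+ a b rewrite ℕ→ℚ≡mkℚ a | ℕ→ℚ≡mkℚ b =
  cong (ℚ._/ 1) (trans (ℤP.pos-+ a b) (sym (cong₂ ℤ._+_ (ℤP.*-identityʳ (+ a)) (ℤP.*-identityʳ (+ b)))))

ℕ→ℚ-homo-* : ∀ a b → ℕ→ℚ (a ℕ.* b) ≡ ℕ→ℚ a * ℕ→ℚ b
ℕ→ℚ-homo-* a b rewrite ℕ→ℚ≡mkℚ a | ℕ→ℚ≡mkℚ b = cong (ℚ._/ 1) (ℤP.pos-* a b)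

ℕ→ℚ-mono-≤ : ∀ {a b} → a ℕ.≤ b → ℕ→ℚ a ≤ ℕ→ℚ b
ℕ→ℚ-mono-≤ {a} {b} a≤b rewrite ℕ→ℚ≡mkℚ a | ℕ→ℚ≡mkℚ b =
  ℚ.*≤* (ℤP.*-monoʳ-≤-nonNeg (+ 1) (ℤ.+≤+ a≤b))

ℕ→ℚ-nonNeg : ∀ a → 0ℚ ≤ ℕ→ℚ a
ℕ→ℚ-nonNeg a = ℕ→ℚ-mono-≤ {0} {a} z≤n

ℕ→ℚ-suc-* : ∀ c e → ℕ→ℚ (suc c) * e ≡ ℕ→ℚ c * e + e
ℕ→ℚ-suc-* c e = begin
  ℕ→ℚ (1 ℕ.+ c) * e       ≡⟨ cong (_* e) (ℕ→ℚ-homo-+ 1 c) ⟩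
  (1ℚ + ℕ→ℚ c) * e        ≡⟨ solve 2 (λ c e → (con 1ℚ :+ c) :* e := c :* e :+ e) refl (ℕ→ℚ c) e ⟩
  ℕ→ℚ c * e + e ∎
  where open ≡-Reasoning

p≤p+q : ∀ p {q} → 0ℚ ≤ q → p ≤ p + q
p≤p+q p {q} q≥0 = subst (_≤ p + q) (+-identityʳ p) (+-monoʳ-≤ p q≥0)

nonNeg+nonNeg : ∀ {x y} → 0ℚ ≤ x → 0ℚ ≤ y → 0ℚ ≤ x + y
nonNeg+nonNeg {x} {y} x≥0 y≥0 = subst (_≤ x + y) (+-identityˡ 0ℚ) (+-mono-≤ x≥0 y≥0)

nonNeg*nonNeg : ∀ {x y} → 0ℚ ≤ x → 0ℚ ≤ y → 0ℚ ≤ x * y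
nonNeg*nonNeg {x} {y} x≥0 y≥0 =
  subst (_≤ x * y) (*-zeroˡ y) (*-monoʳ-≤-nonNeg y {{ℚ.nonNegative y≥0}} x≥0)

pos⇒≰0 : ∀ r .{{_ : Positive r}} → ¬ r ≤ 0ℚ
pos⇒≰0 r r≤0 = <-irrefl refl (<-≤-trans (positive⁻¹ r) r≤0)

floor-nonPos : ∀ p → p ≤ 0ℚ → floor p ℤ.≤ + 0
floor-nonPos p@record{} p≤0 = ℤP.*-cancelʳ-≤-pos (floor p) (+ 0) (↧ p) (begin
  floor p ℤ.* ↧ p ≤⟨ ℤD.[n/d]*d≤n (↥ p) (↧ p) ⟩
  ↥ p             ≡⟨ sym (ℤP.*-identityʳ (↥ p)) ⟩
  ↥ p ℤ.* + 1     ≤⟨ drop-*≤* p≤0 ⟩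
  + 0 ℤ.* ↧ p     ∎)
  where open ℤP.≤-Reasoning

ceiling-nonNeg : ∀ p → 0ℚ ≤ p → + 0 ℤ.≤ ceiling p
ceiling-nonNeg p@record{} 0≤p = ℤP.neg-mono-≤ (floor-nonPos (- p) (neg-antimono-≤ 0≤p))

ℤ→ℚ-nonNeg : ∀ z → + 0 ℤ.≤ z → 0ℚ ≤ ℤ→ℚ z
ℤ→ℚ-nonNeg (+ a) _ = ℕ→ℚ-nonNeg a

p≤∣↥p∣ : ∀ p → p ≤ ℕ→ℚ ℤ.∣ ↥ p ∣
p≤∣↥p∣ (mkℚ (+ a) d _) rewrite ℕ→ℚ≡mkℚ a =
  ℚ.*≤* (subst (ℤ._≤ + a ℤ.* + suc d) (sym (ℤP.*-identityʳ (+ a)))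
    (subst (+ a ℤ.≤_) (ℤP.pos-* a (suc d)) (ℤ.+≤+ (ℕP.m≤m*n a (suc d)))))
p≤∣↥p∣ (mkℚ -[1+ a ] d _) rewrite ℕ→ℚ≡mkℚ (suc a) = ℚ.*≤* ℤ.-≤+

countBelow : ℚ → List ℚ → ℕ
countBelow t []       = 0
countBelow t (a ∷ as) with a <? t
... | yes _ = suc (countBelow t as)
... | no _  = countBelow t as

countBelow≤length : ∀ t ts → countBelow t ts ℕ.≤ length ts
countBelow≤length t []       = z≤n
countBelow≤length t (a ∷ as) with a <? t
... | yes _ = s≤s (countBelow≤length t as)
... | no _  = ℕP.m≤n⇒m≤1+n (countBelow≤length t as)

countBelow-mono : ∀ {t t'} ts → t ≤ t' → countBelow t ts ℕ.≤ countBelow t' ts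
countBelow-mono [] t≤t' = z≤n
countBelow-mono {t} {t'} (a ∷ as) t≤t' with a <? t | a <? t'
... | yes _   | yes _   = s≤s (countBelow-mono as t≤t')
... | yes a<t | no a≮t' = contradiction (<-≤-trans a<t t≤t') a≮t'
... | no _    | yes _   = ℕP.m≤n⇒m≤1+n (countBelow-mono as t≤t')
... | no _    | no _    = countBelow-mono as t≤t'

countBelow-< : ∀ {a t ts} → a ∈ ts → a < t → countBelow a ts ℕ.< countBelow t ts
countBelow-< {a} {t} {_ ∷ as} (here refl) a<t with a <? a | a <? t
... | yes a<a | _       = contradiction a<a (<-irrefl refl)
... | no _    | yes _   = s≤s (countBelow-mono as (<⇒≤ a<t))
... | no _    | no a≮t  = contradiction a<t a≮t
countBelow-< {a} {t} {b ∷ bs} (there a∈bs) a<t with b <? a | b <? t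
... | yes _   | yes _   = s≤s (countBelow-< a∈bs a<t)
... | yes b<a | no b≮t  = contradiction (<-trans b<a a<t) b≮t
... | no _    | yes _   = ℕP.m≤n⇒m≤1+n (countBelow-< a∈bs a<t)
... | no _    | no _    = countBelow-< a∈bs a<t

countBelow-<length : ∀ {a ts} → a ∈ ts → countBelow a ts ℕ.< length ts
countBelow-<length {a} {_ ∷ as} (here refl) with a <? a
... | yes a<a = contradiction a<a (<-irrefl refl)
... | no _    = s≤s (countBelow≤length a as)
countBelow-<length {a} {b ∷ bs} (there a∈bs) with b <? a
... | yes _ = s≤s (countBelow-<length a∈bs)
... | no _  = ℕP.m<n⇒m<1+n (countBelow-<length a∈bs)

length-filter-split : ∀ {X : Set} {P : X → Set} (P? : Decidable P) xs →
  length xs ≡ length (filter P? xs) ℕ.+ length (filter (¬? ∘ P?) xs)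
length-filter-split P? []       = refl
length-filter-split P? (x ∷ xs) with P? x
... | yes _ = cong suc (length-filter-split P? xs)
... | no _  = trans (cong suc (length-filter-split P? xs)) (sym (ℕP.+-suc _ _))

length-concatMap-const : ∀ {A B : Set} (f : A → List B) {c} → (∀ x → length (f x) ≡ c) →
  ∀ xs → length (concatMap f xs) ≡ length xs ℕ.* c
length-concatMap-const f eq []       = refl
length-concatMap-const f eq (x ∷ xs) =
  trans (length-++ (f x)) (cong₂ ℕ._+_ (eq x) (length-concatMap-const f eq xs))

module Grid (e : ℚ) .{{e>0 : Positive e}} where

  private instance
    e≥0 : ℚ.NonNegative e
    e≥0 = pos⇒nonNeg e
    e≢0 : ℚ.NonZero e
    e≢0 = pos⇒nonZero e

  grid : ℕ → ℚ
  grid c = ℕ→ℚ c * e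

  grid-homo-+ : ∀ a b → grid (a ℕ.+ b) ≡ grid a + grid b
  grid-homo-+ a b = trans (cong (_* e) (ℕ→ℚ-homo-+ a b)) (*-distribʳ-+ e (ℕ→ℚ a) (ℕ→ℚ b))

  grid-mono-≤ : ∀ {a b} → a ℕ.≤ b → grid a ≤ grid b
  grid-mono-≤ a≤b = *-monoʳ-≤-nonNeg e (ℕ→ℚ-mono-≤ a≤b)

  grid-nonNeg : ∀ a → 0ℚ ≤ grid a
  grid-nonNeg a = subst (_≤ grid a) (*-zeroˡ e) (grid-mono-≤ {0} {a} z≤n)

  grid-archimedean : ∀ t → t ≤ grid ℤ.∣ ↥ (t * 1/ e) ∣
  grid-archimedean t = begin
    t                             ≡⟨ sym (*-identityʳ t) ⟩
    t * 1ℚ                        ≡⟨ cong (t *_) (sym (*-inverseˡ e)) ⟩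
    t * (1/ e * e)                ≡⟨ sym (*-assoc t (1/ e) e) ⟩
    t * 1/ e * e                  ≤⟨ *-monoʳ-≤-nonNeg e (p≤∣↥p∣ (t * 1/ e)) ⟩
    grid ℤ.∣ ↥ (t * 1/ e) ∣       ∎
    where open ≤-Reasoning

  -- The test t ≤? grid c is passed as an argument instead of being matched with `with`:
  -- abstracting over it makes Agda normalise the ℚ decision procedure on open terms.
  leastGridAbove : ℚ → ℕ → ℕ
  leastGridAbove-step : ∀ t c → Dec (t ≤ grid c) → ℕ

  leastGridAbove t zero    = zero
  leastGridAbove t (suc c) = leastGridAbove-step t c (t ≤? grid c)

  leastGridAbove-step t c (yes _) = leastGridAbove t c
  leastGridAbove-step t c (no _)  = suc c

  leastGridAbove-bounds : ∀ {t} c → 0ℚ ≤ t → t ≤ grid c →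
    t ≤ grid (leastGridAbove t c) × grid (leastGridAbove t c) ≤ t + e
  leastGridAbove-step-bounds : ∀ {t} c (t≤?grid : Dec (t ≤ grid c)) → 0ℚ ≤ t → t ≤ grid (suc c) →
    t ≤ grid (leastGridAbove-step t c t≤?grid) × grid (leastGridAbove-step t c t≤?grid) ≤ t + e

  leastGridAbove-bounds {t} zero t≥0 t≤0 = t≤0 , (begin
    grid 0       ≡⟨ *-zeroˡ e ⟩
    0ℚ           ≡⟨ sym (+-identityʳ 0ℚ) ⟩
    0ℚ + 0ℚ      ≤⟨ +-mono-≤ t≥0 (<⇒≤ (positive⁻¹ e)) ⟩
    t + e        ∎)
    where open ≤-Reasoning
  leastGridAbove-bounds {t} (suc c) = leastGridAbove-step-bounds c (t ≤? grid c)

  leastGridAbove-step-bounds c (yes t≤grid') t≥0 _      = leastGridAbove-bounds c t≥0 t≤grid'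
  leastGridAbove-step-bounds {t} c (no t≰grid') _ t≤grid = t≤grid , (begin
    grid (suc c)  ≡⟨ ℕ→ℚ-suc-* c e ⟩
    grid c + e    ≤⟨ +-monoˡ-≤ e (<⇒≤ (≰⇒> t≰grid')) ⟩
    t + e         ∎)
    where open ≤-Reasoning

  gridCeiling : ℚ → ℕ
  gridCeiling t = leastGridAbove t ℤ.∣ ↥ (t * 1/ e) ∣

  gridCeiling-bounds : ∀ {t} → 0ℚ ≤ t → t ≤ grid (gridCeiling t) × grid (gridCeiling t) ≤ t + e
  gridCeiling-bounds {t} t≥0 = leastGridAbove-bounds ℤ.∣ ↥ (t * 1/ e) ∣ t≥0 (grid-archimedean t)

  record GridAligning (B : ℚ) (ts : List ℚ) : Set where
    field
      delay        : ℚ → ℚ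
      delay-mono   : ∀ {u v} → u ≤ v → delay u ≤ delay v
      delay-nonNeg : ∀ u → 0ℚ ≤ delay u
      delay-≤      : ∀ u → delay u ≤ B
      aligned      : ∀ {a} → a ∈ ts → ∃ λ c → a + delay a ≡ grid c

  module _ (ts : List ℚ) (ts≥0 : All (0ℚ ≤_) ts) where

    -- Counting the points strictly below a makes the displacement jump by at least e between
    -- distinct points of ts, which absorbs the rounding error of at most e.
    target : ℚ → ℕ
    target a = gridCeiling a ℕ.+ countBelow a ts

    displacement : ℚ → ℚ
    displacement a = grid (target a) - a

    displacement-bounds : ∀ {a} → a ∈ ts →
      grid (countBelow a ts) ≤ displacement a × displacement a ≤ grid (suc (countBelow a ts))
    displacement-bounds {a} a∈ts = lower , upper
      where
      open ≤-Reasoning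
      ⌈a⌉ = gridCeiling a
      n<a = countBelow a ts
      bounds = gridCeiling-bounds (All.lookup ts≥0 a∈ts)
      target-split : grid (target a) - a ≡ grid ⌈a⌉ + grid n<a - a
      target-split = cong (_- a) (grid-homo-+ ⌈a⌉ n<a)
      lower = begin
        grid n<a                   ≡⟨ solve 2 (λ a g → g := a :+ g :- a) refl a _ ⟩
        a + grid n<a - a           ≤⟨ +-monoˡ-≤ (- a) (+-monoˡ-≤ _ (proj₁ bounds)) ⟩
        grid ⌈a⌉ + grid n<a - a    ≡⟨ sym target-split ⟩
        displacement a             ∎
      upper = begin
        displacement a             ≡⟨ target-split ⟩
        grid ⌈a⌉ + grid n<a - a    ≤⟨ +-monoˡ-≤ (- a) (+-monoˡ-≤ _ (proj₂ bounds)) ⟩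
        a + e + grid n<a - a       ≡⟨ solve 3 (λ a e g → a :+ e :+ g :- a := g :+ e) refl a e _ ⟩
        grid n<a + e               ≡⟨ sym (ℕ→ℚ-suc-* n<a e) ⟩
        grid (suc n<a)             ∎

    displacement-mono : ∀ {a b} → a ∈ ts → b ∈ ts → a ≤ b → displacement a ≤ displacement b
    displacement-mono {a} {b} a∈ts b∈ts a≤b with a <? b
    ... | no a≮b = ≤-reflexive (cong displacement (≤-antisym a≤b (≮⇒≥ a≮b)))
    ... | yes a<b = begin
      displacement a                 ≤⟨ proj₂ (displacement-bounds a∈ts) ⟩
      grid (suc (countBelow a ts))   ≤⟨ grid-mono-≤ (countBelow-< a∈ts a<b) ⟩
      grid (countBelow b ts)         ≤⟨ proj₁ (displacement-bounds b∈ts) ⟩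
      displacement b                 ∎
      where open ≤-Reasoning

    displacement-≤ : ∀ {a} → a ∈ ts → displacement a ≤ grid (length ts)
    displacement-≤ a∈ts =
      ≤-trans (proj₂ (displacement-bounds a∈ts)) (grid-mono-≤ (countBelow-<length a∈ts))

    displacement-nonNeg : ∀ {a} → a ∈ ts → 0ℚ ≤ displacement a
    displacement-nonNeg {a} a∈ts =
      ≤-trans (grid-nonNeg (countBelow a ts)) (proj₁ (displacement-bounds a∈ts))

    maxDisplacementUpTo : ℚ → ℚ
    maxDisplacementUpTo u = max 0ℚ (map displacement (filter (_≤? u) ts))

    maxDisplacementUpTo-at : ∀ {a} → a ∈ ts → maxDisplacementUpTo a ≡ displacement a
    maxDisplacementUpTo-at {a} a∈ts =
      max≈v⁺ {v = displacement a} {0ℚ} {map displacement (filter (_≤? a) ts)}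
        (∈-map⁺ displacement (∈-filter⁺ (_≤? a) a∈ts ≤-refl))
        (All.map⁺ (All.tabulate λ b∈ → let b∈ts , b≤a = ∈-filter⁻ (_≤? a) b∈ in
          displacement-mono b∈ts a∈ts b≤a))
        (displacement-nonNeg a∈ts)

    gridAligning : GridAligning (grid (length ts)) ts
    gridAligning = record
      { delay        = maxDisplacementUpTo
      ; delay-mono   = λ {u} {v} u≤v →
          max-mono-⊆ {xs = map displacement (filter (_≤? u) ts)} {map displacement (filter (_≤? v) ts)}
            ≤-refl (map⁺ displacement (filter⁺′ (_≤? u) (_≤? v) (λ a≤u → ≤-trans a≤u u≤v) {ts} ⊆-refl))
      ; delay-nonNeg = λ u → v≤max⁺ 0ℚ (map displacement (filter (_≤? u) ts)) (inj₁ ≤-refl)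
      ; delay-≤      = λ u → max≤v⁺ (grid-nonNeg (length ts))
          (All.map⁺ (All.tabulate λ a∈ → displacement-≤ (proj₁ (∈-filter⁻ (_≤? u) a∈))))
      ; aligned      = λ {a} a∈ts → target a , (begin
          a + maxDisplacementUpTo a ≡⟨ cong (λ d → a + d) (maxDisplacementUpTo-at a∈ts) ⟩
          a + (grid (target a) - a)  ≡⟨ solve 2 (λ a g → a :+ (g :- a) := g) refl a _ ⟩
          grid (target a)            ∎)
      }
      where open ≡-Reasoning

maxFin-nonNeg : ∀ n f → 0ℚ ≤ maxFin n f
maxFin-nonNeg zero    f = ≤-refl
maxFin-nonNeg (suc n) f = ≤-trans (maxFin-nonNeg n (f ∘ suc)) (p≤q⊔p (f zero) _)

maxFin-upper : ∀ n f i → f i ≤ maxFin n f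
maxFin-upper (suc n) f zero    = p≤p⊔q (f zero) _
maxFin-upper (suc n) f (suc i) = ≤-trans (maxFin-upper n (λ i → f (suc i)) i) (p≤q⊔p (f zero) _)

maxFin-lub : ∀ n f {b} → 0ℚ ≤ b → (∀ i → f i ≤ b) → maxFin n f ≤ b
maxFin-lub zero    f b≥0 f≤b = b≥0
maxFin-lub (suc n) f b≥0 f≤b =
  ⊔-lub (f≤b zero) (maxFin-lub n (λ i → f (suc i)) b≥0 (λ i → f≤b (suc i)))

module _ {m n k : ℕ} (p : Times n k) where

  completion≤makespan : ∀ (σ : Schedule m n k) i j → start σ i j + p i j ≤ makespan p σ
  completion≤makespan σ i j = ≤-trans (maxFin-upper k (λ j → start σ i j + p i j) j)
    (maxFin-upper n (λ i → maxFin k (λ j → start σ i j + p i j)) i)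

  makespan-lub : ∀ (σ : Schedule m n k) {b} → 0ℚ ≤ b → (∀ i j → start σ i j + p i j ≤ b) →
                 makespan p σ ≤ b
  makespan-lub σ b≥0 ≤b = maxFin-lub n _ b≥0 (λ i → maxFin-lub k _ b≥0 (≤b i))

  makespan-nonNeg : ∀ (σ : Schedule m n k) → 0ℚ ≤ makespan p σ
  makespan-nonNeg σ = maxFin-nonNeg n _

module Delaying (d : ℚ → ℚ) (d-mono : ∀ {u v} → u ≤ v → d u ≤ d v) (d-nonNeg : ∀ u → 0ℚ ≤ d u) where

  delayed : ∀ {m n k} → Schedule m n k → Schedule m n k
  delayed σ = record { shop = shop σ ; start = λ i j → start σ i j + d (start σ i j) }

  private
    +-d-≤ : ∀ a {p} b → 0ℚ ≤ p → a + p ≤ b → a + d a + p ≤ b + d b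
    +-d-≤ a {p} b p≥0 a+p≤b = begin
      a + d a + p   ≡⟨ xy∙z≈xz∙y a (d a) p ⟩
      a + p + d a   ≤⟨ +-mono-≤ a+p≤b (d-mono (≤-trans (p≤p+q a p≥0) a+p≤b)) ⟩
      b + d b       ∎
      where open ≤-Reasoning

  NoOverlap-delayed : ∀ a b {p q} → 0ℚ ≤ p → 0ℚ ≤ q → NoOverlap a p b q →
                      NoOverlap (a + d a) p (b + d b) q
  NoOverlap-delayed a b p≥0 q≥0 (inj₁ a+p≤b)        = inj₁ (+-d-≤ a b p≥0 a+p≤b)
  NoOverlap-delayed a b p≥0 q≥0 (inj₂ (inj₁ b+q≤a)) = inj₂ (inj₁ (+-d-≤ b a q≥0 b+q≤a))
  NoOverlap-delayed a b p≥0 q≥0 (inj₂ (inj₂ empty)) = inj₂ (inj₂ empty)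

  module _ {m n k : ℕ} {p : Times n k} (p≥0 : ∀ i j → 0ℚ ≤ p i j) {σ : Schedule m n k} where

    delayed-feasible : Feasible p σ → Feasible p (delayed σ)
    delayed-feasible F = record
      { nonneg  = λ i j → nonNeg+nonNeg (nonneg i j) (d-nonNeg _)
      ; machine = λ i i' j i≢i' same →
          NoOverlap-delayed _ _ (p≥0 i j) (p≥0 i' j) (machine i i' j i≢i' same)
      ; job     = λ i j j' j≢j' → NoOverlap-delayed _ _ (p≥0 i j) (p≥0 i j') (job i j j' j≢j')
      }
      where open Feasible F

    makespan-delayed : ∀ {B} → (∀ u → d u ≤ B) → makespan p (delayed σ) ≤ makespan p σ + B
    makespan-delayed {B} d≤B = makespan-lub p (delayed σ)
      (nonNeg+nonNeg (makespan-nonNeg p σ) (≤-trans (d-nonNeg 0ℚ) (d≤B 0ℚ)))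
      (λ i j → begin
        start σ i j + d (start σ i j) + p i j   ≡⟨ xy∙z≈xz∙y (start σ i j) (d (start σ i j)) (p i j) ⟩
        start σ i j + p i j + d (start σ i j)   ≤⟨ +-mono-≤ (completion≤makespan p σ i j) (d≤B _) ⟩
        makespan p σ + B                        ∎)
      where open ≤-Reasoning hiding (start)

module Packing {X : Set} (a q : X → ℚ) (γ : ℚ) .{{γ>0 : Positive γ}} where

  Disjoint : X → X → Set
  Disjoint x y = NoOverlap (a x) (q x) (a y) (q y)

  Within : ℚ → ℚ → X → Set
  Within L C x = L ≤ a x × a x + q x ≤ C

  -- x splits the other intervals into those before and those after it; fuel bounds the length
  pack : ∀ fuel xs → length xs ℕ.≤ fuel → AllPairs Disjoint xs → All (λ x → γ ≤ q x) xs →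
         ∀ {L C} → L ≤ C → All (Within L C) xs → L + ℕ→ℚ (length xs) * γ ≤ C
  pack _ [] _ _ _ {L} L≤C _ =
    subst (_≤ _) (sym (trans (cong (λ s → L + s) (*-zeroˡ γ)) (+-identityʳ L))) L≤C
  pack (suc fuel) (x ∷ xs) (s≤s |xs|≤fuel) (x#xs ∷ disjoint) (γ≤qx ∷ γ≤q) {L} {C} L≤C
       ((L≤ax , ax+qx≤C) ∷ within) = begin
    L + ℕ→ℚ (suc (length xs)) * γ          ≡⟨ cong (λ n → L + ℕ→ℚ (suc n) * γ) (length-filter-split Before? xs) ⟩
    L + ℕ→ℚ (suc (#before ℕ.+ #after)) * γ  ≡⟨ count-split ⟩
    L + ℕ→ℚ #before * γ + γ + ℕ→ℚ #after * γ ≤⟨ +-monoˡ-≤ _ (+-mono-≤ packBefore γ≤qx) ⟩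
    a x + q x + ℕ→ℚ #after * γ              ≤⟨ packAfter ⟩
    C                                       ∎
    where
    open ≤-Reasoning
    Before? : Decidable (λ y → a y + q y ≤ a x)
    Before? y = a y + q y ≤? a x
    before = filter Before? xs
    after  = filter (¬? ∘ Before?) xs
    #before = length before
    #after  = length after

    count-split : L + ℕ→ℚ (suc (#before ℕ.+ #after)) * γ ≡ L + ℕ→ℚ #before * γ + γ + ℕ→ℚ #after * γ
    count-split = begin-equality
      L + ℕ→ℚ (suc (#before ℕ.+ #after)) * γ     ≡⟨ cong (λ s → L + s) (ℕ→ℚ-suc-* (#before ℕ.+ #after) γ) ⟩
      L + (ℕ→ℚ (#before ℕ.+ #after) * γ + γ)     ≡⟨ cong (λ z → L + (z * γ + γ)) (ℕ→ℚ-homo-+ #before #after) ⟩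
      L + ((ℕ→ℚ #before + ℕ→ℚ #after) * γ + γ)
        ≡⟨ solve 4 (λ L b f g → L :+ ((b :+ f) :* g :+ g) := L :+ b :* g :+ g :+ f :* g)
             refl L (ℕ→ℚ #before) (ℕ→ℚ #after) γ ⟩
      L + ℕ→ℚ #before * γ + γ + ℕ→ℚ #after * γ   ∎

    packBefore : L + ℕ→ℚ #before * γ ≤ a x
    packBefore = pack fuel before (ℕP.≤-trans (length-filter Before? xs) |xs|≤fuel)
      (AllPairs.filter⁺ Before? disjoint) (All.filter⁺ Before? γ≤q) L≤ax
      (All.zipWith (λ ((L≤ay , _) , ay+qy≤ax) → L≤ay , ay+qy≤ax)
        (All.filter⁺ Before? within , All.all-filter Before? xs))

    endsBefore : ∀ {y} → ¬ (a y + q y ≤ a x) → γ ≤ q y → Disjoint x y → a x + q x ≤ a y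
    endsBefore _  _    (inj₁ ax+qx≤ay)             = ax+qx≤ay
    endsBefore ¬before _    (inj₂ (inj₁ ay+qy≤ax))      = contradiction ay+qy≤ax ¬before
    endsBefore _  _    (inj₂ (inj₂ (inj₁ qx≡0)))   = contradiction (subst (γ ≤_) qx≡0 γ≤qx) (pos⇒≰0 γ)
    endsBefore _  γ≤qy (inj₂ (inj₂ (inj₂ qy≡0)))   = contradiction (subst (γ ≤_) qy≡0 γ≤qy) (pos⇒≰0 γ)

    packAfter : a x + q x + ℕ→ℚ #after * γ ≤ C
    packAfter = pack fuel after (ℕP.≤-trans (length-filter (¬? ∘ Before?) xs) |xs|≤fuel)
      (AllPairs.filter⁺ (¬? ∘ Before?) disjoint) (All.filter⁺ (¬? ∘ Before?) γ≤q) ax+qx≤C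
      (All.zipWith (λ (¬before , γ≤qy , x#y , (_ , ay+qy≤C)) → endsBefore ¬before γ≤qy x#y , ay+qy≤C)
        (All.all-filter (¬? ∘ Before?) xs ,
         All.filter⁺ (¬? ∘ Before?) (All.zip (γ≤q , All.zip (x#xs , within)))))

NoOverlap-+ : ∀ c {a p b q} → NoOverlap a p b q → NoOverlap (c + a) p (c + b) q
NoOverlap-+ c {a} {p} {b} {q} (inj₁ a+p≤b) =
  inj₁ (subst (_≤ c + b) (sym (+-assoc c a p)) (+-monoʳ-≤ c a+p≤b))
NoOverlap-+ c {a} {p} {b} {q} (inj₂ (inj₁ b+q≤a)) =
  inj₂ (inj₁ (subst (_≤ c + a) (sym (+-assoc c b q)) (+-monoʳ-≤ c b+q≤a)))
NoOverlap-+ c (inj₂ (inj₂ empty)) = inj₂ (inj₂ empty)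

module HeavyOperations {m n k : ℕ} (p : Times n k) (σ : Schedule m n k) (F : Feasible p σ)
                       (makespan≤1 : makespan p σ ≤ 1ℚ) (γ : ℚ) .{{γ>0 : Positive γ}} where

  open Feasible F

  Operation : Set
  Operation = Fin n × Fin k

  heavy? : (o : Operation) → Dec (γ ≤ p (proj₁ o) (proj₂ o))
  heavy? (i , j) = γ ≤? p i j

  allOps : List Operation
  allOps = cartesianProduct (allFin n) (allFin k)

  heavyOps : List Operation
  heavyOps = filter heavy? allOps

  -- machine j of shop ℓ gets the slot [jm + ℓ, jm + ℓ + 1) of the line [0, km]
  slot : Operation → Fin (k ℕ.* m)
  slot (i , j) = combine j (shop σ i)

  offset : Operation → ℚ
  offset o = ℕ→ℚ (toℕ (slot o))

  placedStart : Operation → ℚ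
  placedStart o@(i , j) = offset o + start σ i j

  duration : Operation → ℚ
  duration (i , j) = p i j

  open Packing placedStart duration γ

  placedEnd≤ : ∀ o → placedStart o + duration o ≤ ℕ→ℚ (suc (toℕ (slot o)))
  placedEnd≤ o@(i , j) = begin
    offset o + start σ i j + p i j     ≡⟨ +-assoc (offset o) (start σ i j) (p i j) ⟩
    offset o + (start σ i j + p i j)   ≤⟨ +-monoʳ-≤ (offset o) (≤-trans (completion≤makespan p σ i j) makespan≤1) ⟩
    offset o + 1ℚ                      ≡⟨ trans (+-comm (offset o) 1ℚ) (sym (ℕ→ℚ-homo-+ 1 (toℕ (slot o)))) ⟩
    ℕ→ℚ (suc (toℕ (slot o)))           ∎
    where open ≤-Reasoning hiding (start)

  placed-within : ∀ o → Within 0ℚ (ℕ→ℚ (k ℕ.* m)) o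
  placed-within o@(i , j) = nonNeg+nonNeg (ℕ→ℚ-nonNeg (toℕ (slot o))) (nonneg i j) ,
    ≤-trans (placedEnd≤ o) (ℕ→ℚ-mono-≤ (toℕ<n (slot o)))

  separated : ∀ o o' → toℕ (slot o) ℕ.< toℕ (slot o') → placedStart o + duration o ≤ placedStart o'
  separated o o'@(i' , j') slot<slot' = begin
    placedStart o + duration o   ≤⟨ placedEnd≤ o ⟩
    ℕ→ℚ (suc (toℕ (slot o)))     ≤⟨ ℕ→ℚ-mono-≤ slot<slot' ⟩
    offset o'                    ≡⟨ sym (+-identityʳ (offset o')) ⟩
    offset o' + 0ℚ               ≤⟨ +-monoʳ-≤ (offset o') (nonneg i' j') ⟩
    placedStart o'               ∎
    where open ≤-Reasoning hiding (start)

  disjoint : ∀ o o' → o ≢ o' → Disjoint o o'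
  disjoint o@(i , j) o'@(i' , j') o≢o' with ℕP.<-cmp (toℕ (slot o)) (toℕ (slot o'))
  ... | tri< slot<slot' _ _ = inj₁ (separated o o' slot<slot')
  ... | tri> _ _ slot'<slot = inj₂ (inj₁ (separated o' o slot'<slot))
  ... | tri≈ _ slot≡slot' _ with combine-injective j (shop σ i) j' (shop σ i') (toℕ-injective slot≡slot')
  ...   | refl , sameShop =
    subst (λ c → NoOverlap (offset o + start σ i j) (p i j) (ℕ→ℚ c + start σ i' j) (p i' j))
      slot≡slot' (NoOverlap-+ (offset o) (machine i i' j (λ { refl → o≢o' refl }) sameShop))

  ∈-heavyOps : ∀ {i j} → γ ≤ p i j → (i , j) ∈ heavyOps
  ∈-heavyOps {i} {j} γ≤pij = ∈-filter⁺ heavy? (∈-cartesianProduct⁺ (∈-allFin i) (∈-allFin j)) γ≤pij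

  heavyOps-count : ℕ→ℚ (length heavyOps) * γ ≤ ℕ→ℚ (k ℕ.* m)
  heavyOps-count = subst (_≤ ℕ→ℚ (k ℕ.* m)) (+-identityˡ _)
    (pack (length heavyOps) heavyOps ℕP.≤-refl
      (AllPairs.filter⁺ heavy? (AllPairs.map (disjoint _ _) (cartesianProduct⁺ (allFin⁺ n) (allFin⁺ k))))
      (All.all-filter heavy? allOps) (ℕ→ℚ-nonNeg (k ℕ.* m)) (All.tabulate λ {o} _ → placed-within o))

  module _ (τ : Schedule m n k) where

    startsOfJob : Operation → List ℚ
    startsOfJob (i , _) = tabulate (start τ i)

    startsOfHeavyJobs : List ℚ
    startsOfHeavyJobs = concatMap startsOfJob heavyOps

    start∈startsOfHeavyJobs : ∀ {i j₀} → γ ≤ p i j₀ → ∀ j → start τ i j ∈ startsOfHeavyJobs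
    start∈startsOfHeavyJobs γ≤pij₀ j =
      ∈-concatMap⁺ startsOfJob (Any.map (λ { refl → ∈-tabulate⁺ j }) (∈-heavyOps γ≤pij₀))

    length-startsOfHeavyJobs : length startsOfHeavyJobs ≡ length heavyOps ℕ.* k
    length-startsOfHeavyJobs =
      length-concatMap-const startsOfJob (λ (i , _) → length-tabulate (start τ i)) heavyOps

    startsOfHeavyJobs-nonNeg : (∀ i j → 0ℚ ≤ start τ i j) → All (0ℚ ≤_) startsOfHeavyJobs
    startsOfHeavyJobs-nonNeg τ≥0 =
      All.concat⁺ (All.map⁺ (All.universal (λ (i , _) → All.tabulate⁺ (τ≥0 i)) heavyOps))

anyFin-sound : ∀ k f → T (anyFin k f) → ∃ λ (j : Fin k) → T (f j)
anyFin-sound (suc k) f any with f zero in eq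
... | true  = zero , subst T (sym eq) tt
... | false with anyFin-sound k (λ j → f (suc j)) any
...   | j , fj = suc j , fj

big?-sound : ∀ {n k} γ (p : Times n k) i → T (big? γ p i) → Big γ p i
big?-sound {k = k} γ p i big with anyFin-sound k (λ j → γ ℚ.≤ᵇ p i j) big
... | j , γ≤ᵇpij = j , ≤ᵇ⇒≤ γ≤ᵇpij

module Reduce (m k N : ℕ) .{{_ : NonZero m}} .{{_ : NonZero k}} .{{_ : NonZero N}} (x : ℕ) where

  instance
    Γ≢0 : NonZero (Γ m k N x)
    Γ≢0 = ℕP.m^n≢0 (D m k N) (2 ℕ.^ x) {{D≢0}}
      where
      D≢0 = ℕP.m*n≢0 (14 ℕ.* m ℕ.* k ℕ.^ 3) N
              {{ℕP.m*n≢0 (14 ℕ.* m) (k ℕ.^ 3) {{ℕP.m*n≢0 14 m}} {{ℕP.m^n≢0 k 3}}}}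

    γ>0 : Positive (γ m k N x)
    γ>0 = normalize-pos 1 (Γ m k N x)

  γ≥0 : 0ℚ ≤ γ m k N x
  γ≥0 = <⇒≤ (positive⁻¹ _)

  roundUp-nonNeg : ∀ {q} → 0ℚ ≤ q → 0ℚ ≤ roundUp m k N x q
  roundUp-nonNeg {q} q≥0 = nonNeg*nonNeg
    (ℤ→ℚ-nonNeg _ (ceiling-nonNeg _ (nonNeg*nonNeg q≥0 (ℕ→ℚ-nonNeg (Γ m k N x ℕ.* Γ m k N x)))))
    (nonNeg*nonNeg γ≥0 γ≥0)

  module _ {n : ℕ} (p : Times n k) where

    reduce-nonNeg : (∀ i j → 0ℚ ≤ p i j) → ∀ i j → 0ℚ ≤ reduce m k N x p i j
    reduce-nonNeg p≥0 i j = cases (big? (γ m k N x) p i) (γ m k N x * γ m k N x ℚ.≤ᵇ p i j)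
      where
      cases : ∀ b c → 0ℚ ≤ (if b then roundUp m k N x (p i j) else (if c then 0ℚ else p i j))
      cases true  _     = roundUp-nonNeg (p≥0 i j)
      cases false true  = ≤-refl
      cases false false = p≥0 i j

    -- small operations keep their length or drop to 0
    reduce-big⇒big : ∀ i → Big (γ m k N x) (reduce m k N x p) i → Big (γ m k N x) p i
    reduce-big⇒big i (j , γ≤p'ij) =
      cases (big? (γ m k N x) p i) (γ m k N x * γ m k N x ℚ.≤ᵇ p i j) (big?-sound _ p i) γ≤p'ij
      where
      cases : ∀ b c → (T b → Big (γ m k N x) p i) →
              γ m k N x ≤ (if b then roundUp m k N x (p i j) else (if c then 0ℚ else p i j)) →
              Big (γ m k N x) p i
      cases true  _     sound _       = sound tt
      cases false true  _     γ≤0     = contradiction γ≤0 (pos⇒≰0 (γ m k N x))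
      cases false false _     γ≤pij   = j , γ≤pij

h*γ≤km⇒hk*γ²≤mk²*γ : ∀ {h k m γ} → 0ℚ ≤ γ → ℕ→ℚ h * γ ≤ ℕ→ℚ (k ℕ.* m) →
                       ℕ→ℚ (h ℕ.* k) * (γ * γ) ≤ ℕ→ℚ (m ℕ.* k ℕ.^ 2) * γ
h*γ≤km⇒hk*γ²≤mk²*γ {h} {k} {m} {γ} γ≥0 hγ≤km = begin
  ℕ→ℚ (h ℕ.* k) * (γ * γ)             ≡⟨ cong (_* (γ * γ)) (ℕ→ℚ-homo-* h k) ⟩
  ℕ→ℚ h * ℕ→ℚ k * (γ * γ)
    ≡⟨ solve 3 (λ h k γ → h :* k :* (γ :* γ) := h :* γ :* (k :* γ)) refl (ℕ→ℚ h) (ℕ→ℚ k) γ ⟩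
  ℕ→ℚ h * γ * (ℕ→ℚ k * γ)             ≤⟨ *-monoʳ-≤-nonNeg (ℕ→ℚ k * γ) {{kγ≥0}} hγ≤km ⟩
  ℕ→ℚ (k ℕ.* m) * (ℕ→ℚ k * γ)         ≡⟨ cong (_* (ℕ→ℚ k * γ)) (ℕ→ℚ-homo-* k m) ⟩
  ℕ→ℚ k * ℕ→ℚ m * (ℕ→ℚ k * γ)
    ≡⟨ solve 3 (λ k m γ → k :* m :* (k :* γ) := m :* (k :* (k :* con 1ℚ)) :* γ) refl (ℕ→ℚ k) (ℕ→ℚ m) γ ⟩
  ℕ→ℚ m * (ℕ→ℚ k * (ℕ→ℚ k * 1ℚ)) * γ  ≡⟨ cong (_* γ) (sym mk²) ⟩
  ℕ→ℚ (m ℕ.* k ℕ.^ 2) * γ             ∎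
  where
  open ≤-Reasoning
  kγ≥0 = ℚ.nonNegative (nonNeg*nonNeg (ℕ→ℚ-nonNeg k) γ≥0)
  mk² : ℕ→ℚ (m ℕ.* (k ℕ.* (k ℕ.* 1))) ≡ ℕ→ℚ m * (ℕ→ℚ k * (ℕ→ℚ k * 1ℚ))
  mk² = trans (ℕ→ℚ-homo-* m _)
    (cong (ℕ→ℚ m *_) (trans (ℕ→ℚ-homo-* k _) (cong (ℕ→ℚ k *_) (ℕ→ℚ-homo-* k 1))))

lemma5 : (m k N : ℕ) .{{_ : NonZero m}} .{{_ : NonZero k}} .{{_ : NonZero N}} →
         2 ℕ.≤ N →
         (n : ℕ) (p : Times n k) → (∀ i j → 0ℚ ≤ p i j) →
         (∃ λ (σ : Schedule m n k) → Feasible p σ × makespan p σ ≤ 1ℚ) →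
         (x : ℕ) → ReduceStopsAt m k N p x →
         ∀ (σ : Schedule m n k) → Feasible (reduce m k N x p) σ →
         ∃ λ (σ' : Schedule m n k) →
           Feasible (reduce m k N x p) σ' ×
           Restricted (γ m k N x) (reduce m k N x p) σ' ×
           makespan (reduce m k N x p) σ' ≤
             makespan (reduce m k N x p) σ + ℕ→ℚ (m ℕ.* k ℕ.^ 2) * γ m k N x
lemma5 m k N _ n p p≥0 (σ₀ , F₀ , σ₀≤1) x _ σ F =
  delayed σ , delayed-feasible p'≥0 F , restricted , makespan-bound
  where
  open Reduce m k N x
  γₓ = γ m k N x
  p'≥0 = reduce-nonNeg p p≥0
  open HeavyOperations p σ₀ F₀ σ₀≤1 γₓ
  instance _ = pos*pos⇒pos γₓ γₓ
  open Grid (γₓ * γₓ) using (module GridAligning; gridAligning)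
  open GridAligning (gridAligning (startsOfHeavyJobs σ) (startsOfHeavyJobs-nonNeg σ (Feasible.nonneg F)))
  open Delaying delay delay-mono delay-nonNeg

  restricted : Restricted γₓ (reduce m k N x p) (delayed σ)
  restricted i big j = aligned (start∈startsOfHeavyJobs σ (proj₂ (reduce-big⇒big p i big)) j)

  makespan-bound : makespan (reduce m k N x p) (delayed σ) ≤
                   makespan (reduce m k N x p) σ + ℕ→ℚ (m ℕ.* k ℕ.^ 2) * γₓ
  makespan-bound = ≤-trans (makespan-delayed p'≥0 {σ} delay-≤)
    (+-monoʳ-≤ (makespan (reduce m k N x p) σ)
      (subst (λ c → ℕ→ℚ c * (γₓ * γₓ) ≤ ℕ→ℚ (m ℕ.* k ℕ.^ 2) * γₓ)
        (sym (length-startsOfHeavyJobs σ)) (h*γ≤km⇒hk*γ²≤mk²*γ {length heavyOps} γ≥0 heavyOps-count)))
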